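{- Let $B\geq 2$ and let $n,k$ be integers with $1\leq k\leq n$. Then $$s_B(n)=s_B\left(n- k\left \lfloor \frac{n}{k}\right\rfloor \right)+ s_B(k) \left \lfloor \frac{n}{k}\right\rfloor-\sum_{i=1}^{\left \lfloor n/k\right\rfloor } \widehat{c}_B(n-ik,k).$$
   Context: For an integer $B\geq 2$ and an integer $a\geq 0$, $s_B(a)$ denotes the sum of the base-$B$ digits of $a$ (with $s_B(0)=0$). For integers $a,b\geq 0$, $c_B(a,b)$ denotes the base-$B$ carry sum of $a+b$: the sum of all carried numbers produced when computing $a+b$ by the traditional column addition algorithm in base $B$. Then $\widehat{c}_B(a,b):=(B-1)c_B(a,b)$. -}

module Defs where

open import Data.Nat using (ℕ; zero; suc; _+_; _*_; _∸_; _≤_; NonZero)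
open import Data.Nat.DivMod using (_/_; _%_)
open import Data.Integer using (ℤ; +_)
import Data.Integer as ℤ

-- Sum of base-B digits, computed with fuel. With fuel ≥ a (each step
-- strictly decreases a ≥ 1 since B ≥ 2), the fuel never runs out early.
sB-fuel : (B : ℕ) → .{{NonZero B}} → ℕ → ℕ → ℕ
sB-fuel B zero    a = 0
sB-fuel B (suc f) a = a % B + sB-fuel B f (a / B)

sB : (B : ℕ) → .{{NonZero B}} → ℕ → ℕ
sB B a = sB-fuel B a a

-- Column addition of a + b in base B with incoming carry c (0 or 1):
-- returns the sum of all carries produced. Fuel bounds the number of columns.
cB-fuel : (B : ℕ) → .{{NonZero B}} → ℕ → ℕ → ℕ → ℕ → ℕ
cB-fuel B zero    a b c = 0
cB-fuel B (suc f) a b c =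
  let carry = (a % B + b % B + c) / B
  in carry + cB-fuel B f (a / B) (b / B) carry

-- c_B(a,b): the base-B carry sum of a + b (fuel a + b + 1 suffices).
cB : (B : ℕ) → .{{NonZero B}} → ℕ → ℕ → ℕ
cB B a b = cB-fuel B (suc (a + b)) a b 0

ĉB : (B : ℕ) → .{{NonZero B}} → ℕ → ℕ → ℕ
ĉB B a b = (B ∸ 1) * cB B a b

sum1 : ℕ → (ℕ → ℕ) → ℕ
sum1 zero    f = 0
sum1 (suc m) f = sum1 m f + f (suc m)

{-# OPTIONS --safe #-}
module Submission where

-- Adding y and k column by column, each carry turns B units of the digit sum
-- into a single unit of the next column, so s_B(y) + s_B(k) = s_B(y + k) + ĉ_B(y, k).
-- Applying this to y = n - ik for i = 1, …, ⌊n/k⌋ telescopes from s_B(n) down to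
-- s_B(n - k⌊n/k⌋), picking up s_B(k) and one term ĉ_B(n - ik, k) at each step.

open import Defs
open import Relation.Binary.PropositionalEquality

module DigitSums where
  open import Data.Nat
    using (ℕ; zero; suc; _+_; _*_; _∸_; _≤_; NonZero; z≤n)
  open import Data.Nat.Properties
  open import Data.Nat.DivMod
    using (_/_; _%_; m≡m%n+[m/n]*n; [m+kn]%n≡m%n; +-distrib-/-∣ʳ; m*n/n≡m; m/n<m; m/n*n≤m)
  open import Data.Nat.Divisibility using (divides-refl)
  open import Data.Nat.Tactic.RingSolver using (solve-∀)
  import Data.Integer as ℤ
  import Data.Integer.Properties as ℤ
  open ≡-Reasoning

  sB-fuel-0 : ∀ B .{{_ : NonZero B}} f → sB-fuel B f 0 ≡ 0
  sB-fuel-0 B       zero    = refl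
  sB-fuel-0 (suc b) (suc f) = sB-fuel-0 (suc b) f

  /-≤-pred : ∀ B .{{_ : NonZero B}} → 2 ≤ B → ∀ x f → x ≤ suc f → x / B ≤ f
  /-≤-pred (suc b) _   zero    f _   = z≤n
  /-≤-pred B       2≤B (suc x) f x≤ = ≤-pred (≤-trans (m/n<m (suc x) B 2≤B) x≤)

  sB-fuel-stable : ∀ B .{{_ : NonZero B}} → 2 ≤ B → ∀ f g a → a ≤ f → a ≤ g →
                   sB-fuel B f a ≡ sB-fuel B g a
  sB-fuel-stable B _   zero    g       _ z≤n _   = sym (sB-fuel-0 B g)
  sB-fuel-stable B _   (suc f) zero    _ _   z≤n = sB-fuel-0 B (suc f)
  sB-fuel-stable B 2≤B (suc f) (suc g) a a≤f a≤g =
    cong (a % B +_) (sB-fuel-stable B 2≤B f g (a / B)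
                       (/-≤-pred B 2≤B a f a≤f) (/-≤-pred B 2≤B a g a≤g))

  sB-≡-sB-fuel : ∀ B .{{_ : NonZero B}} → 2 ≤ B → ∀ a f → a ≤ f → sB B a ≡ sB-fuel B f a
  sB-≡-sB-fuel B 2≤B a f a≤f = sB-fuel-stable B 2≤B a f a ≤-refl a≤f

  -- d is the total of the lowest column of a + b + c: d % B is the last digit of
  -- the sum and d / B the carry into the next column.
  module LowestColumn (a b c B : ℕ) .{{_ : NonZero B}} where

    d : ℕ
    d = a % B + b % B + c

    +-split : a + b + c ≡ d + (a / B + b / B) * B
    +-split = begin
      a + b + c
        ≡⟨ cong₂ (λ x y → x + y + c) (m≡m%n+[m/n]*n a B) (m≡m%n+[m/n]*n b B) ⟩
      (a % B + a / B * B) + (b % B + b / B * B) + c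
        ≡⟨ regroup (a % B) (a / B) (b % B) (b / B) c B ⟩
      d + (a / B + b / B) * B ∎
      where
      regroup : ∀ p q r s c B → p + q * B + (r + s * B) + c ≡ p + r + c + (q + s) * B
      regroup = solve-∀

    +-%-column : (a + b + c) % B ≡ d % B
    +-%-column = trans (cong (_% B) +-split) ([m+kn]%n≡m%n d (a / B + b / B) B)

    +-/-column : (a + b + c) / B ≡ a / B + b / B + d / B
    +-/-column = begin
      (a + b + c) / B                 ≡⟨ cong (_/ B) +-split ⟩
      (d + (a / B + b / B) * B) / B   ≡⟨ +-distrib-/-∣ʳ d (divides-refl (a / B + b / B)) ⟩
      d / B + (a / B + b / B) * B / B ≡⟨ cong (d / B +_) (m*n/n≡m (a / B + b / B) B) ⟩
      d / B + (a / B + b / B)         ≡⟨ +-comm (d / B) _ ⟩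
      a / B + b / B + d / B           ∎

  sB-fuel-+-carries : ∀ b → 2 ≤ suc b → ∀ f x y c → x + y + c ≤ f →
    sB-fuel (suc b) f x + sB-fuel (suc b) f y + c
      ≡ sB-fuel (suc b) f (x + y + c) + b * cB-fuel (suc b) f x y c
  sB-fuel-+-carries b _ zero x y c x+y+c≤0 =
    trans (m+n≡0⇒n≡0 (x + y) (n≤0⇒n≡0 x+y+c≤0)) (sym (*-zeroʳ b))
  sB-fuel-+-carries b 2≤B (suc f) x y c x+y+c≤ = begin
    (x % B + P) + (y % B + Q) + c         ≡⟨ gather (x % B) (y % B) c P Q ⟩
    d + (P + Q)                           ≡⟨ cong (_+ (P + Q)) (m≡m%n+[m/n]*n d B) ⟩
    d % B + κ * B + (P + Q)               ≡⟨ absorb (d % B) κ P Q (s x′) C ih ⟩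
    d % B + s x′ + b * (κ + C)            ≡⟨ cong₂ (λ u v → u + s v + b * (κ + C))
                                                   (sym +-%-column) (sym +-/-column) ⟩
    (x + y + c) % B + s ((x + y + c) / B) + b * (κ + C) ∎
    where
    B = suc b
    open LowestColumn x y c B
    s : ℕ → ℕ
    s = sB-fuel B f
    P Q κ C x′ : ℕ
    P = s (x / B)
    Q = s (y / B)
    κ = d / B
    C = cB-fuel B f (x / B) (y / B) κ
    x′ = x / B + y / B + κ
    ih : P + Q + κ ≡ s x′ + b * C
    ih = sB-fuel-+-carries b 2≤B f (x / B) (y / B) κ
           (subst (_≤ f) +-/-column (/-≤-pred B 2≤B (x + y + c) f x+y+c≤))
    gather : ∀ p q c P Q → p + P + (q + Q) + c ≡ (p + q + c) + (P + Q)
    gather = solve-∀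
    -- A carry κ out of the column removes κ * B from the digit but adds κ to the rest.
    absorb : ∀ r κ P Q S C → P + Q + κ ≡ S + b * C →
             r + κ * B + (P + Q) ≡ r + S + b * (κ + C)
    absorb r κ P Q S C eq = begin
      r + κ * B + (P + Q)   ≡⟨ split r κ b P Q ⟩
      r + b * κ + (P + Q + κ) ≡⟨ cong (r + b * κ +_) eq ⟩
      r + b * κ + (S + b * C) ≡⟨ merge r κ b S C ⟩
      r + S + b * (κ + C)   ∎
      where
      split : ∀ r κ b P Q → r + κ * suc b + (P + Q) ≡ r + b * κ + (P + Q + κ)
      split = solve-∀
      merge : ∀ r κ b S C → r + b * κ + (S + b * C) ≡ r + S + b * (κ + C)
      merge = solve-∀

  sB-+-ĉB : ∀ B .{{_ : NonZero B}} → 2 ≤ B → ∀ y k → sB B y + sB B k ≡ sB B (y + k) + ĉB B y k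
  sB-+-ĉB (suc b) 2≤B y k = begin
    sB B y + sB B k                     ≡⟨ cong₂ _+_ (sB-≡-sB-fuel B 2≤B y F y≤F)
                                                     (sB-≡-sB-fuel B 2≤B k F k≤F) ⟩
    sB-fuel B F y + sB-fuel B F k       ≡⟨ sym (+-identityʳ _) ⟩
    sB-fuel B F y + sB-fuel B F k + 0   ≡⟨ sB-fuel-+-carries b 2≤B F y k 0 y+k+0≤F ⟩
    sB-fuel B F (y + k + 0) + ĉB B y k  ≡⟨ cong (λ z → sB-fuel B F z + ĉB B y k) (+-identityʳ (y + k)) ⟩
    sB-fuel B F (y + k) + ĉB B y k      ≡⟨ cong (_+ ĉB B y k) (sym (sB-≡-sB-fuel B 2≤B (y + k) F (n≤1+n _))) ⟩
    sB B (y + k) + ĉB B y k             ∎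
    where
    B = suc b
    F = suc (y + k)
    y≤F : y ≤ F
    y≤F = ≤-trans (m≤m+n y k) (n≤1+n _)
    k≤F : k ≤ F
    k≤F = ≤-trans (m≤n+m k y) (n≤1+n _)
    y+k+0≤F : y + k + 0 ≤ F
    y+k+0≤F = subst (_≤ F) (sym (+-identityʳ _)) (n≤1+n _)

  ∸-*-suc : ∀ n k j → suc j * k ≤ n → n ∸ j * k ≡ n ∸ suc j * k + k
  ∸-*-suc n k j sjk≤n = begin
    n ∸ j * k                 ≡⟨ cong (_∸ j * k) (sym (m∸n+n≡m sjk≤n)) ⟩
    y + (k + j * k) ∸ j * k   ≡⟨ cong (_∸ j * k) (sym (+-assoc y k (j * k))) ⟩
    y + k + j * k ∸ j * k     ≡⟨ m+n∸n≡m (y + k) (j * k) ⟩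
    y + k                     ∎
    where
    y = n ∸ suc j * k

  sB-telescope : ∀ B .{{_ : NonZero B}} → 2 ≤ B → ∀ n k j → j * k ≤ n →
    sB B n + sum1 j (λ i → ĉB B (n ∸ i * k) k) ≡ sB B (n ∸ j * k) + sB B k * j
  sB-telescope B 2≤B n k zero _ =
    trans (+-identityʳ _) (sym (trans (cong (sB B n +_) (*-zeroʳ (sB B k))) (+-identityʳ _)))
  sB-telescope B 2≤B n k (suc j) sjk≤n = begin
    sB B n + (S + C)                    ≡⟨ sym (+-assoc (sB B n) S C) ⟩
    sB B n + S + C                      ≡⟨ cong (_+ C) (sB-telescope B 2≤B n k j (≤-trans (m≤n+m (j * k) k) sjk≤n)) ⟩
    sB B (n ∸ j * k) + sB B k * j + C   ≡⟨ swap (sB B (n ∸ j * k)) (sB B k * j) C ⟩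
    sB B (n ∸ j * k) + C + sB B k * j   ≡⟨ cong (λ z → sB B z + C + sB B k * j) (∸-*-suc n k j sjk≤n) ⟩
    sB B (y + k) + C + sB B k * j       ≡⟨ cong (_+ sB B k * j) (sym (sB-+-ĉB B 2≤B y k)) ⟩
    sB B y + sB B k + sB B k * j        ≡⟨ fold (sB B y) (sB B k) j ⟩
    sB B y + sB B k * suc j             ∎
    where
    S = sum1 j (λ i → ĉB B (n ∸ i * k) k)
    y = n ∸ suc j * k
    C = ĉB B y k
    swap : ∀ a b c → a + b + c ≡ a + c + b
    swap = solve-∀
    fold : ∀ a b c → a + b + b * c ≡ a + b * suc c
    fold = solve-∀

  sB-+-Σĉ : ∀ B .{{_ : NonZero B}} → 2 ≤ B → ∀ n k .{{_ : NonZero k}} →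
    sB B n + sum1 (n / k) (λ i → ĉB B (n ∸ i * k) k)
      ≡ sB B (n ∸ k * (n / k)) + sB B k * (n / k)
  sB-+-Σĉ B 2≤B n k = subst (λ m → sB B n + Σĉ ≡ sB B (n ∸ m) + sB B k * (n / k)) (*-comm (n / k) k)
                            (sB-telescope B 2≤B n k (n / k) (m/n*n≤m n k))
    where
    Σĉ = sum1 (n / k) (λ i → ĉB B (n ∸ i * k) k)

  +-≡⇒≡-ℤ : ∀ {s c} a b → s + c ≡ a + b → ℤ.+ s ≡ (ℤ.+ a ℤ.+ ℤ.+ b) ℤ.- ℤ.+ c
  +-≡⇒≡-ℤ {s} {c} a b s+c≡a+b = sym (begin
    (ℤ.+ a ℤ.+ ℤ.+ b) ℤ.- ℤ.+ c   ≡⟨ cong (ℤ._- ℤ.+ c) (ℤ.pos-+ a b) ⟨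
    ℤ.+ (a + b) ℤ.- ℤ.+ c         ≡⟨ cong (λ t → ℤ.+ t ℤ.- ℤ.+ c) s+c≡a+b ⟨
    ℤ.+ (s + c) ℤ.- ℤ.+ c         ≡⟨ ℤ.[+m]-[+n]≡m⊖n (s + c) c ⟩
    (s + c) ℤ.⊖ c                 ≡⟨ ℤ.⊖-≥ (m≤n+m c s) ⟩
    ℤ.+ (s + c ∸ c)               ≡⟨ cong ℤ.+_ (m+n∸n≡m s c) ⟩
    ℤ.+ s                         ∎)

open DigitSums
open import Data.Nat using (ℕ; _≤_; _*_; _∸_; NonZero)
open import Data.Nat.DivMod using (_/_)
open import Data.Integer using (ℤ; +_; _+_; _-_)

corollary1p2 : (B n k : ℕ) → .{{_ : NonZero B}} → .{{_ : NonZero k}} →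
    2 ≤ B → 1 ≤ k → k ≤ n →
    + sB B n ≡ (+ sB B (n ∸ k * (n / k)) + + (sB B k * (n / k)))
    - + sum1 (n / k) (λ i → ĉB B (n ∸ i * k) k)
corollary1p2 B n k 2≤B _ _ = +-≡⇒≡-ℤ (sB B (n ∸ k * (n / k))) (sB B k * (n / k)) (sB-+-Σĉ B 2≤B n k)
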